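{- In the edge-distinguishing game (EDGe) played on the Moser spindle $M$ (with $\lambda(M)$ colors), Player 1 has a winning strategy.
   Context: The Moser spindle $M$ is the graph with vertices $v_1,\dots,v_7$ and the 11 edges $v_1v_2, v_1v_5, v_1v_6, v_1v_7, v_2v_7, v_5v_6, v_2v_3, v_3v_7, v_4v_5, v_4v_6, v_3v_4$. For a positive integer $k$ let $[k]=\{1,\dots,k\}$. A $k$-coloring $c:V(G)\to[k]$ induces $c'(\{u,v\})=\{c(u),c(v)\}$ (a multiset); $c$ is edge-distinguishing if $c'$ is injective, and $\lambda(G)$ is the least $k$ admitting such a coloring. A partial coloring on $U\subseteq V(G)$ has partial induced edge coloring on $G[U]$. EDGe on $G$: two players, Player 1 first, alternately color an uncolored vertex with a color from $[\lambda(G)]$; a move is legal iff afterwards the partial induced edge coloring of the colored vertices is injective. The player making the last legal move wins. A winning strategy guarantees a win regardless of the opponent's play. -}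

module Defs where

open import Data.Nat using (ℕ; _≤_)
open import Data.Fin using (Fin; zero; suc; _≟_)
open import Data.Maybe using (Maybe; just; nothing)
open import Data.Product using (_×_; _,_; proj₁; proj₂; Σ)
open import Data.Sum using (_⊎_)
open import Relation.Binary.PropositionalEquality using (_≡_)
open import Relation.Nullary using (yes; no)

record Graph : Set where
  field
    n     : ℕ
    m     : ℕ
    edge  : Fin m → Fin n × Fin n
open Graph public

SameMultiset : {k : ℕ} → Fin k → Fin k → Fin k → Fin k → Set
SameMultiset a b c d = (a ≡ c × b ≡ d) ⊎ (a ≡ d × b ≡ c)

EdgeDistinguishing : (G : Graph) (k : ℕ) → (Fin (n G) → Fin k) → Set
EdgeDistinguishing G k c =
  ∀ (i j : Fin (m G)) →
  SameMultiset (c (proj₁ (edge G i))) (c (proj₂ (edge G i)))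
               (c (proj₁ (edge G j))) (c (proj₂ (edge G j))) →
  i ≡ j

IsLambda : Graph → ℕ → Set
IsLambda G k =
  Σ (Fin (n G) → Fin k) (EdgeDistinguishing G k) ×
  (∀ j → Σ (Fin (n G) → Fin j) (EdgeDistinguishing G j) → k ≤ j)

-- Partial colorings: nothing = uncolored.
Position : Graph → ℕ → Set
Position G k = Fin (n G) → Maybe (Fin k)

PartialInjective : (G : Graph) (k : ℕ) → Position G k → Set
PartialInjective G k p =
  ∀ (i j : Fin (m G)) (a b c d : Fin k) →
  p (proj₁ (edge G i)) ≡ just a → p (proj₂ (edge G i)) ≡ just b →
  p (proj₁ (edge G j)) ≡ just c → p (proj₂ (edge G j)) ≡ just d →
  SameMultiset a b c d → i ≡ j

update : {G : Graph} {k : ℕ} → Position G k → Fin (n G) → Fin k → Position G k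
update p v c w with w ≟ v
... | yes _ = just c
... | no  _ = p w

LegalMove : (G : Graph) (k : ℕ) → Position G k → Fin (n G) → Fin k → Set
LegalMove G k p v c = p v ≡ nothing × PartialInjective G k (update {G} {k} p v c)

-- Normal play (last legal move wins).
data ToMoveWins (G : Graph) (k : ℕ) (p : Position G k) : Set
data ToMoveLoses (G : Graph) (k : ℕ) (p : Position G k) : Set

data ToMoveWins G k p where
  move : (v : Fin (n G)) (c : Fin k) → LegalMove G k p v c →
         ToMoveLoses G k (update {G} {k} p v c) → ToMoveWins G k p

data ToMoveLoses G k p where
  allMoves : (∀ (v : Fin (n G)) (c : Fin k) → LegalMove G k p v c →
              ToMoveWins G k (update {G} {k} p v c)) → ToMoveLoses G k p

emptyPosition : (G : Graph) (k : ℕ) → Position G k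
emptyPosition G k _ = nothing

Player1Wins : Graph → ℕ → Set
Player1Wins G k = ToMoveWins G k (emptyPosition G k)

v1 v2 v3 v4 v5 v6 v7 : Fin 7
v1 = zero
v2 = suc zero
v3 = suc (suc zero)
v4 = suc (suc (suc zero))
v5 = suc (suc (suc (suc zero)))
v6 = suc (suc (suc (suc (suc zero))))
v7 = suc (suc (suc (suc (suc (suc zero)))))

moserEdge : Fin 11 → Fin 7 × Fin 7
moserEdge zero = v1 , v2
moserEdge (suc zero) = v1 , v5
moserEdge (suc (suc zero)) = v1 , v6
moserEdge (suc (suc (suc zero))) = v1 , v7
moserEdge (suc (suc (suc (suc zero)))) = v2 , v7
moserEdge (suc (suc (suc (suc (suc zero))))) = v5 , v6
moserEdge (suc (suc (suc (suc (suc (suc zero)))))) = v2 , v3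
moserEdge (suc (suc (suc (suc (suc (suc (suc zero))))))) = v3 , v7
moserEdge (suc (suc (suc (suc (suc (suc (suc (suc zero)))))))) = v4 , v5
moserEdge (suc (suc (suc (suc (suc (suc (suc (suc (suc zero))))))))) = v4 , v6
moserEdge (suc (suc (suc (suc (suc (suc (suc (suc (suc (suc zero)))))))))) = v3 , v4

MoserSpindle : Graph
MoserSpindle = record { n = 7 ; m = 11 ; edge = moserEdge }

{-# OPTIONS --safe #-}
-- The colouring 0,1,2,2,3,4,5 of v1,…,v7 distinguishes all edges, and a pruned exhaustive search
-- rules out five colours, so λ(M) = 6. The spindle consists of the diamonds v1v2v7v3 and v1v5v6v4,
-- sharing v1 and with tips v3, v4 joined by an edge. Player 1 colours v1 with 0, and after
-- Player 2's reply colours with 0 the tip of the diamond Player 2 left untouched. The two middle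
-- vertices of that diamond now see colour 0 at both v1 and the tip, so colouring one of them would
-- repeat an edge colour {0, x}: they stay uncoloured for good. Only two vertices of the other
-- diamond are left; Player 2 colours one and Player 1 (by a check of all replies) can always colour
-- the last, making the fifth and final move.
module Submission where

open import Defs
open import Data.Nat using (ℕ; suc; _≤_; _≤?_; s≤s⁻¹)
open import Data.Nat.Properties using (≰⇒>)
open import Data.Fin using (Fin; zero; #_; inject≤) renaming (_≟_ to _≟ᶠ_)
open import Data.Fin.Properties using (all?; any?; sequence; inject≤-injective)
open import Data.Maybe using (Maybe; just; nothing; is-just; from-just)
import Data.Maybe as Maybe
open import Data.Maybe.Effectful using (applicative)
open import Data.Maybe.Properties using (just-injective; ≡-dec)
open import Data.Product using (Σ; _×_; _,_; proj₁; proj₂)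
open import Data.Sum using (_⊎_; inj₁; inj₂)
open import Data.Bool using (if_then_else_; _∨_)
open import Data.List using (List; []; _∷_)
open import Data.Vec using ([]; _∷_; lookup)
open import Data.Empty using (⊥-elim)
open import Function using (_∘_; const)
open import Function.Definitions using (Injective)
open import Relation.Binary.PropositionalEquality using (_≡_; _≢_; refl; sym; trans)
open import Relation.Nullary using (Dec; yes; no; ¬_; contradiction)
open import Relation.Nullary.Decidable using (_×-dec_; _⊎-dec_; _→-dec_; map′; from-yes)

sameMultiset? : ∀ {k} (a b c d : Fin k) → Dec (SameMultiset a b c d)
sameMultiset? a b c d = (a ≟ᶠ c ×-dec b ≟ᶠ d) ⊎-dec (a ≟ᶠ d ×-dec b ≟ᶠ c)

sameMultiset-sym : ∀ {k} {a b c d : Fin k} → SameMultiset a b c d → SameMultiset c d a b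
sameMultiset-sym (inj₁ (p , q)) = inj₁ (sym p , sym q)
sameMultiset-sym (inj₂ (p , q)) = inj₂ (sym q , sym p)

sameMultiset-map : ∀ {j k} {f : Fin j → Fin k} → Injective _≡_ _≡_ f → ∀ {a b c d} →
                   SameMultiset (f a) (f b) (f c) (f d) → SameMultiset a b c d
sameMultiset-map f-inj (inj₁ (p , q)) = inj₁ (f-inj p , f-inj q)
sameMultiset-map f-inj (inj₂ (p , q)) = inj₂ (f-inj p , f-inj q)

edgeDistinguishing? : ∀ G k c → Dec (EdgeDistinguishing G k c)
edgeDistinguishing? G k c = all? λ i → all? λ j →
  sameMultiset? (c (proj₁ (edge G i))) (c (proj₂ (edge G i))) (c (proj₁ (edge G j))) (c (proj₂ (edge G j)))
    →-dec (i ≟ᶠ j)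

edgeDistinguishing-∘ : ∀ {G j k} {f : Fin j → Fin k} → Injective _≡_ _≡_ f →
                       ∀ c → EdgeDistinguishing G j c → EdgeDistinguishing G k (f ∘ c)
edgeDistinguishing-∘ f-inj c ed i j = ed i j ∘ sameMultiset-map f-inj

isLambda : ∀ {G k} → Σ (Fin (n G) → Fin (suc k)) (EdgeDistinguishing G (suc k)) →
           (∀ c → ¬ EdgeDistinguishing G k c) → IsLambda G (suc k)
isLambda {G} {k} colouring none = colouring , atLeast
  where
  atLeast : ∀ j → Σ (Fin (n G) → Fin j) (EdgeDistinguishing G j) → suc k ≤ j
  atLeast j (c , ed) with suc k ≤? j
  ... | yes k<j = k<j
  ... | no k≮j  =
    ⊥-elim (none (embed ∘ c) (edgeDistinguishing-∘ (λ {x} {y} → inject≤-injective j≤k j≤k x y) c ed))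
    where
    j≤k : j ≤ k
    j≤k = s≤s⁻¹ (≰⇒> k≮j)
    embed : Fin j → Fin k
    embed x = inject≤ x j≤k

module _ (G : Graph) (k : ℕ) where

  private
    Vertex = Fin (n G)
    Colour = Fin k

  ColouredPairsDistinct : (x y z w : Maybe Colour) (Q : Set) → Set
  ColouredPairsDistinct x y z w Q = ∀ a b c d → x ≡ just a → y ≡ just b → z ≡ just c → w ≡ just d →
                                    SameMultiset a b c d → Q

  colouredPairsDistinct? : ∀ {Q} → Dec Q → (x y z w : Maybe Colour) → Dec (ColouredPairsDistinct x y z w Q)
  colouredPairsDistinct? Q? nothing _ _ _ = yes λ _ _ _ _ ()
  colouredPairsDistinct? Q? (just _) nothing _ _ = yes λ _ _ _ _ _ ()
  colouredPairsDistinct? Q? (just _) (just _) nothing _ = yes λ _ _ _ _ _ _ ()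
  colouredPairsDistinct? Q? (just _) (just _) (just _) nothing = yes λ _ _ _ _ _ _ _ ()
  colouredPairsDistinct? Q? (just a) (just b) (just c) (just d) with Q? | sameMultiset? a b c d
  ... | yes q | _     = yes λ _ _ _ _ _ _ _ _ _ → q
  ... | no ¬q | yes s = no λ distinct → ¬q (distinct a b c d refl refl refl refl s)
  ... | no _  | no ¬s = yes λ { _ _ _ _ refl refl refl refl s → contradiction s ¬s }

  Distinguishes : Position G k → Fin (m G) → Fin (m G) → Set
  Distinguishes p i j = ColouredPairsDistinct (p (proj₁ (edge G i))) (p (proj₂ (edge G i)))
                                              (p (proj₁ (edge G j))) (p (proj₂ (edge G j))) (i ≡ j)

  distinguishes? : ∀ p i j → Dec (Distinguishes p i j)
  distinguishes? p i j = colouredPairsDistinct? (i ≟ᶠ j) (p (proj₁ (edge G i))) (p (proj₂ (edge G i)))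
                                                         (p (proj₁ (edge G j))) (p (proj₂ (edge G j)))

  distinguishes-sym : ∀ p {i j} → Distinguishes p i j → Distinguishes p j i
  distinguishes-sym p ij a b c d e₁ e₂ e₃ e₄ s = sym (ij c d a b e₃ e₄ e₁ e₂ (sameMultiset-sym s))

  Incident : Vertex → Fin (m G) → Set
  Incident v i = proj₁ (edge G i) ≡ v ⊎ proj₂ (edge G i) ≡ v

  incident? : ∀ v i → Dec (Incident v i)
  incident? v i = proj₁ (edge G i) ≟ᶠ v ⊎-dec proj₂ (edge G i) ≟ᶠ v

  update-≢ : ∀ {p v c w} → w ≢ v → update {G} {k} p v c w ≡ p w
  update-≢ {v = v} {w = w} w≢v with w ≟ᶠ v
  ... | yes w≡v = contradiction w≡v w≢v
  ... | no _    = refl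

  update-partialInjective : ∀ {p v c} → PartialInjective G k p →
                            (∀ i → Incident v i → ∀ j → Distinguishes (update {G} {k} p v c) i j) →
                            PartialInjective G k (update {G} {k} p v c)
  update-partialInjective {p} {v} {c} inj atV i j with incident? v i | incident? v j
  ... | yes vi | _      = atV i vi j
  ... | no _   | yes vj = distinguishes-sym (update {G} {k} p v c) (atV j vj i)
  ... | no ¬vi | no ¬vj = λ a b c d e₁ e₂ e₃ e₄ →
    inj i j a b c d (unchanged (¬vi ∘ inj₁) e₁) (unchanged (¬vi ∘ inj₂) e₂)
                    (unchanged (¬vj ∘ inj₁) e₃) (unchanged (¬vj ∘ inj₂) e₄)
    where
    unchanged : ∀ {w x} → w ≢ v → update {G} {k} p v c w ≡ x → p w ≡ x
    unchanged w≢v eq = trans (sym (update-≢ w≢v)) eq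

  update-partialInjective? : ∀ {p} → PartialInjective G k p → ∀ v c →
                             Dec (PartialInjective G k (update {G} {k} p v c))
  update-partialInjective? {p} inj v c = map′ (update-partialInjective inj) (λ inj′ i _ j → inj′ i j)
    (all? λ i → incident? v i →-dec all? λ j → distinguishes? (update {G} {k} p v c) i j)

  legalMove? : ∀ {p} → PartialInjective G k p → ∀ v c → Dec (LegalMove G k p v c)
  legalMove? {p} inj v c = ≡-dec _≟ᶠ_ (p v) nothing ×-dec update-partialInjective? inj v c

  empty-partialInjective : PartialInjective G k (emptyPosition G k)
  empty-partialInjective _ _ _ _ _ _ ()

  Extends : (Vertex → Colour) → Position G k → Set
  Extends c p = ∀ v a → p v ≡ just a → c v ≡ a

  extends-update : ∀ {c p} v → Extends c p → Extends c (update {G} {k} p v (c v))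
  extends-update v ext w a eq with w ≟ᶠ v
  ... | yes refl = just-injective eq
  ... | no _     = ext w a eq

  edgeDistinguishing⇒partialInjective : ∀ {c p} → EdgeDistinguishing G k c → Extends c p →
                                        PartialInjective G k p
  edgeDistinguishing⇒partialInjective ed ext i j _ _ _ _ e₁ e₂ e₃ e₄ s
    rewrite sym (ext _ _ e₁) | sym (ext _ _ e₂) | sym (ext _ _ e₃) | sym (ext _ _ e₄) = ed i j s

  NoDistinguishingExtension : Position G k → Set
  NoDistinguishingExtension p = ∀ c → Extends c p → ¬ EdgeDistinguishing G k c

  -- A sound, incomplete search: a result `nothing` proves nothing, and a closed instance is
  -- discharged with `from-just`.
  refuteExtensions : List Vertex → (p : Position G k) → PartialInjective G k p →
                     Maybe (NoDistinguishingExtension p)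
  refuteExtensions []       p inj = nothing
  refuteExtensions (v ∷ vs) p inj = Maybe.map (λ refuted c ext → refuted (c v) c (extends-update v ext))
                                              (sequence applicative refuteColour)
    where
    refuteColour : ∀ a → Maybe (NoDistinguishingExtension (update {G} {k} p v a))
    refuteColour a with update-partialInjective? inj v a
    ... | yes inj′ = refuteExtensions vs (update {G} {k} p v a) inj′
    ... | no ¬inj′ = just λ c ext ed → ¬inj′ (edgeDistinguishing⇒partialInjective ed ext)

  noEdgeDistinguishing : List Vertex → Maybe (∀ c → ¬ EdgeDistinguishing G k c)
  noEdgeDistinguishing vs = Maybe.map (λ refuted c → refuted c λ _ _ ())
                                      (refuteExtensions vs (emptyPosition G k) empty-partialInjective)

  Move : Set
  Move = Vertex × Colour

  Rule : Set
  Rule = (p : Position G k) → PartialInjective G k p → Maybe Move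

  firstLegalMove : Rule
  firstLegalMove p inj with any? (λ v → any? λ c → legalMove? {p} inj v c)
  ... | yes (v , c , _) = just (v , c)
  ... | no _            = nothing

  -- The i-th rule chooses the first player's i-th move; once the rules run out, the opponent
  -- must have no legal move left.
  winsBy       : List Rule → (p : Position G k) → PartialInjective G k p → Maybe (ToMoveWins G k p)
  losesAgainst : List Rule → (p : Position G k) → PartialInjective G k p → Maybe (ToMoveLoses G k p)

  winsBy []       p inj = nothing
  winsBy (σ ∷ σs) p inj with σ p inj
  ... | nothing      = nothing
  ... | just (v , c) with legalMove? inj v c
  ...   | yes legal = Maybe.map (move v c legal) (losesAgainst σs (update {G} {k} p v c) (proj₂ legal))
  ...   | no _      = nothing

  losesAgainst σs p inj =
    Maybe.map allMoves (sequence applicative λ v → sequence applicative λ c → reply v c)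
    where
    reply : ∀ v c → Maybe (LegalMove G k p v c → ToMoveWins G k (update {G} {k} p v c))
    reply v c with legalMove? inj v c
    ... | yes legal  = Maybe.map const (winsBy σs (update {G} {k} p v c) (proj₂ legal))
    ... | no illegal = just λ legal → contradiction legal illegal

  firstPlayerWinsBy : List Rule → Maybe (Player1Wins G k)
  firstPlayerWinsBy σs = winsBy σs (emptyPosition G k) empty-partialInjective

moserColouring : Fin 7 → Fin 6
moserColouring = lookup (# 0 ∷ # 1 ∷ # 2 ∷ # 2 ∷ # 3 ∷ # 4 ∷ # 5 ∷ [])

-- Colouring the triangles v1v2v7 and v1v5v6 first makes the search prune early.
moser-isLambda : IsLambda MoserSpindle 6
moser-isLambda = isLambda (moserColouring , from-yes (edgeDistinguishing? MoserSpindle 6 moserColouring))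
  (from-just (noEdgeDistinguishing MoserSpindle 5 (v1 ∷ v2 ∷ v7 ∷ v5 ∷ v6 ∷ v3 ∷ v4 ∷ [])))

coverUntouchedDiamond : Rule MoserSpindle 6
coverUntouchedDiamond p _ =
  just ((if is-just (p v2) ∨ is-just (p v3) ∨ is-just (p v7) then v4 else v3) , zero)

moserStrategy : List (Rule MoserSpindle 6)
moserStrategy = (λ _ _ → just (v1 , zero)) ∷ coverUntouchedDiamond ∷ firstLegalMove MoserSpindle 6 ∷ []

theorem3p17 : Σ ℕ (λ k → IsLambda MoserSpindle k × Player1Wins MoserSpindle k)
theorem3p17 = 6 , moser-isLambda , from-just (firstPlayerWinsBy MoserSpindle 6 moserStrategy)
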